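{- For every network $N$ the following are equivalent: (1) $N$ has the global lca-property; (2) $\mathfrak{D}_N$ is closed; (3) $\mathfrak{A}_N$ is closed; (4) $\mathfrak{B}_N$ is closed.
   Context: A DAG is a finite directed graph without loops and directed cycles; $u\preceq_G v$ means there is a directed path from $v$ to $u$ (including $u=v$). A network is a DAG with exactly one $\preceq_G$-maximal vertex. For non-empty $A\subseteq V(G)$, $\mathrm{LCA}_G(A)$ is the set of $\preceq_G$-minimal vertices $v$ with $a\preceq_G v$ for all $a\in A$; $G$ has the global lca-property if $|\mathrm{LCA}_G(A)|=1$ for all non-empty $A\subseteq V(G)$. For $v\in V(G)$ let $D_G(v)=\{u: u\preceq_G v\}$ and $\mathrm{ANC}_G(v)=\{u: v\preceq_G u\}$. Put $\mathfrak{D}_G=\{D_G(v): v\in V(G)\}$, $\mathfrak{A}_G=\{\mathrm{ANC}_G(v): v\in V(G)\}$, and $\mathfrak{B}_G=\{B_G(u,v): u,v\in V(G)\}$ where $B_G(u,v)=D_G(u)\cap\mathrm{ANC}_G(v)$. A set system $\mathfrak{C}$ is closed if $A,B\in\mathfrak{C}$ implies $A\cap B\in\mathfrak{C}$ or $A\cap B=\emptyset$. -}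

module Defs where

open import Level using (0ℓ)
open import Data.Nat using (ℕ)
open import Data.Bool using (Bool; T)
open import Data.Fin using (Fin)
open import Data.Fin.Subset as Sub using (Subset)
open import Data.Product using (Σ; ∃; _×_; _,_)
open import Data.Sum using (_⊎_)
open import Relation.Nullary using (¬_)
open import Relation.Binary.PropositionalEquality using (_≡_)
open import Relation.Binary.Construct.Closure.ReflexiveTransitive using (Star)
open import Relation.Unary using (Pred; _∩_; _≐_; Empty)

record Graph : Set where
  field
    n    : ℕ
    edge : Fin n → Fin n → Bool

module _ (G : Graph) where
  open Graph G

  V : Set
  V = Fin n

  Arc : V → V → Set
  Arc u v = T (edge u v)

  _⪯_ : V → V → Set
  u ⪯ v = Star Arc v u

  -- DAG: no loops and no directed cycles, i.e. no arc u → v such that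
  -- u is reachable from v (the case u = v covers loops).
  IsDAG : Set
  IsDAG = ∀ u v → Arc u v → ¬ Star Arc v u

  IsMaximal : V → Set
  IsMaximal v = ∀ w → v ⪯ w → w ≡ v

  IsNetwork : Set
  IsNetwork = IsDAG × (Σ V λ r → IsMaximal r × (∀ w → IsMaximal w → w ≡ r))

  IsCommonAnc : Subset n → V → Set
  IsCommonAnc A v = ∀ a → a Sub.∈ A → a ⪯ v

  IsLCA : Subset n → V → Set
  IsLCA A v = IsCommonAnc A v × (∀ w → IsCommonAnc A w → w ⪯ v → w ≡ v)

  GlobalLCA : Set
  GlobalLCA = ∀ (A : Subset n) → Sub.Nonempty A →
    Σ V λ v → IsLCA A v × (∀ w → IsLCA A w → w ≡ v)

  D : V → Pred V 0ℓ
  D v = λ u → u ⪯ v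

  ANC : V → Pred V 0ℓ
  ANC v = λ u → v ⪯ u

  B : V → V → Pred V 0ℓ
  B u v = D u ∩ ANC v

Closed : {I X : Set} → (I → Pred X 0ℓ) → Set
Closed {I} S = ∀ i j → (Σ I λ k → S k ≐ (S i ∩ S j)) ⊎ Empty (S i ∩ S j)

module _ (G : Graph) where
  open Graph G

  𝔇 : V G → Pred (V G) 0ℓ
  𝔇 = D G

  𝔄 : V G → Pred (V G) 0ℓ
  𝔄 = ANC G

  𝔅 : V G × V G → Pred (V G) 0ℓ
  𝔅 (u , v) = B G u v

{-# OPTIONS --safe #-}
-- In a network every vertex lies below the root, so every set of vertices has common
-- ancestors, and the global lca-property says precisely that every non-empty set A has a
-- join: a common ancestor w with w ⪯ c for every common ancestor c (a minimal common
-- ancestor is unique iff it is the least one). Joins make D u ∩ D v equal to D of the join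
-- of D u ∩ D v and ANC u ∩ ANC v equal to ANC of the join of {u, v}; since
-- B u v ∩ B u′ v′ = (D u ∩ D u′) ∩ (ANC v ∩ ANC v′), closedness of 𝔅 follows.
-- Conversely, if 𝔇 is closed, a minimal common ancestor m of A is least: for a common
-- ancestor c, D m ∩ D c ∋ a ∈ A is some D k, and k is a common ancestor below m, so
-- k = m ⪯ c. If 𝔄 is closed, ANC u ∩ ANC v (which contains the root) is ANC of the join of
-- u and v, and folding gives joins of all finite sets. Closedness of 𝔅 gives that of 𝔄,
-- as B root u = ANC u.
-- Constructively, paths in a finite DAG are shorter than its number of vertices, so ⪯ is
-- decidable and every decidable set has a ⪯-minimal element below each of its members.
module Submission where

open import Defs
open import Data.Product using (_×_)
open import Function.Bundles using (_⇔_)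

open import Level using (0ℓ)
open import Function using (_∘_; flip; id)
open import Function.Bundles using (mk⇔; module Equivalence)
open import Function.Properties.Equivalence using () renaming (trans to ⇔-trans)
open import Data.Nat as ℕ using (ℕ; suc; _+_; _∸_; s≤s; z<s)
open import Data.Nat.Properties using (<⇒≤; ≰⇒>; ∸-monoʳ-<; m<m+n)
open import Data.Nat.Induction using (<-wellFounded)
open import Induction.WellFounded using (Acc; acc)
open import Data.Bool.Properties using (T-≡)
open import Data.Fin as Fin using (Fin; zero; suc; _≟_)
open import Data.Fin.Properties using (any?; all?; pigeonhole)
open import Data.Fin.Subset as Sub using (Subset)
open import Data.Fin.Subset.Properties using (_∈?_)
open import Data.Vec using (tabulate)
open import Data.Vec.Properties using ([]=⇒lookup; lookup⇒[]=; lookup∘tabulate)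
open import Data.List using ([]; _∷_; filter; allFin)
open import Data.List.Membership.Propositional using () renaming (_∈_ to _∈ₗ_)
open import Data.List.Membership.Propositional.Properties using (∈-allFin; ∈-filter⁺; ∈-filter⁻)
open import Data.List.Relation.Unary.Any using (here; there)
open import Data.Product using (∃; _,_; proj₁; proj₂)
open import Data.Sum using (_⊎_; inj₁; inj₂)
open import Data.Empty using (⊥-elim)
open import Relation.Nullary using (¬_; Dec; yes; no)
open import Relation.Nullary.Decidable
  using (isYes; map′; decidable-stable; toWitness; fromWitness; _⊎-dec_; _×-dec_; _→-dec_; ¬?; T?)
open import Relation.Binary using (Rel)
open import Relation.Binary.PropositionalEquality using (_≡_; _≢_; refl; sym; trans; cong; subst)
open import Relation.Binary.Construct.Closure.ReflexiveTransitive using (Star; ε; _◅_; _◅◅_; reverse)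
open import Relation.Unary using (Pred; Decidable; Satisfiable; _⊆_; _∩_; _≐_)
open import Relation.Unary.Properties using (U?)

module FiniteAcyclic {n : ℕ} {R : Rel (Fin n) 0ℓ} (R? : ∀ x y → Dec (R x y))
                     (acyclic : ∀ u v → R u v → ¬ Star R v u) where

  length : ∀ {x y} → Star R x y → ℕ
  length ε       = 0
  length (_ ◅ p) = suc (length p)

  length-◅◅ : ∀ {x y z} (p : Star R x y) (q : Star R y z) → length (p ◅◅ q) ≡ length p + length q
  length-◅◅ ε       q = refl
  length-◅◅ (_ ◅ p) q = cong suc (length-◅◅ p q)

  length-positive : ∀ {x y} (p : Star R x y) → y ≢ x → 0 ℕ.< length p
  length-positive ε       y≢x = ⊥-elim (y≢x refl)
  length-positive (_ ◅ _) _   = z<s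

  vertex : ∀ {x y} (p : Star R x y) → Fin (suc (length p)) → Fin n
  vertex {x} p       zero    = x
  vertex     (_ ◅ p) (suc i) = vertex p i

  reaches-vertex : ∀ {x y} (p : Star R x y) i → Star R x (vertex p i)
  reaches-vertex p       zero    = ε
  reaches-vertex (r ◅ p) (suc i) = r ◅ reaches-vertex p i

  vertex-distinct : ∀ {x y} (p : Star R x y) {i j} → i Fin.< j → vertex p i ≢ vertex p j
  vertex-distinct (r ◅ p) {zero}  {suc j} _         x≡pⱼ =
    acyclic _ _ r (subst (Star R _) (sym x≡pⱼ) (reaches-vertex p j))
  vertex-distinct (_ ◅ p) {suc i} {suc j} (s≤s i<j) = vertex-distinct p i<j

  length<n : ∀ {x y} (p : Star R x y) → length p ℕ.< n
  length<n p = ≰⇒> λ n≤length →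
    let i , j , i<j , pᵢ≡pⱼ = pigeonhole (s≤s n≤length) (vertex p) in vertex-distinct p i<j pᵢ≡pⱼ

  Star≤ : ℕ → Rel (Fin n) 0ℓ
  Star≤ 0       x y = x ≡ y
  Star≤ (suc m) x y = x ≡ y ⊎ ∃ λ z → R x z × Star≤ m z y

  star≤? : ∀ m x y → Dec (Star≤ m x y)
  star≤? 0       x y = x ≟ y
  star≤? (suc m) x y = x ≟ y ⊎-dec any? (λ z → R? x z ×-dec star≤? m z y)

  Star≤⇒Star : ∀ m {x y} → Star≤ m x y → Star R x y
  Star≤⇒Star 0       refl               = ε
  Star≤⇒Star (suc m) (inj₁ refl)        = ε
  Star≤⇒Star (suc m) (inj₂ (_ , r , p)) = r ◅ Star≤⇒Star m p

  Star⇒Star≤ : ∀ {m x y} (p : Star R x y) → length p ℕ.≤ m → Star≤ m x y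
  Star⇒Star≤ {0}     ε       _           = refl
  Star⇒Star≤ {suc m} ε       _           = inj₁ refl
  Star⇒Star≤ {suc m} (r ◅ p) (s≤s len≤m) = inj₂ (_ , r , Star⇒Star≤ p len≤m)

  star? : ∀ x y → Dec (Star R x y)
  star? x y = map′ (Star≤⇒Star n) (λ p → Star⇒Star≤ p (<⇒≤ (length<n p))) (star≤? n x y)

  ◅◅-longer : ∀ {x y z} (p : Star R x y) (q : Star R y z) → z ≢ y →
              n ∸ length (p ◅◅ q) ℕ.< n ∸ length p
  ◅◅-longer p q z≢y with length (p ◅◅ q) | length-◅◅ p q | length<n (p ◅◅ q)
  ... | _ | refl | p◅◅q<n = ∸-monoʳ-< (m<m+n (length p) (length-positive q z≢y)) (<⇒≤ p◅◅q<n)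

  Minimal : Pred (Fin n) 0ℓ → Fin n → Pred (Fin n) 0ℓ
  Minimal P x m = P m × Star R x m × (∀ z → P z → Star R m z → z ≡ m)

  module _ {P : Pred (Fin n) 0ℓ} (P? : Decidable P) where

    private
      descend : ∀ {x y} (p : Star R x y) → P y → Acc ℕ._<_ (n ∸ length p) → ∃ (Minimal P x)
      descend {y = y} p py (acc shorter) with any? (λ z → P? z ×-dec star? y z ×-dec ¬? (z ≟ y))
      ... | yes (z , pz , q , z≢y) = descend (p ◅◅ q) pz (shorter (◅◅-longer p q z≢y))
      ... | no  nothing-below      =
        y , py , p , λ z pz q → decidable-stable (z ≟ y) λ z≢y → nothing-below (z , pz , q , z≢y)

    minimal : ∀ {x} → P x → ∃ (Minimal P x)
    minimal px = descend ε px (<-wellFounded _)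

module _ {n : ℕ} {Q : Pred (Fin n) 0ℓ} (Q? : Decidable Q) where

  toSubset : Subset n
  toSubset = tabulate (isYes ∘ Q?)

  ∈-toSubset : (Sub._∈ toSubset) ≐ Q
  ∈-toSubset =
    (λ {a} a∈ → toWitness (Equivalence.from T-≡ (trans (sym (lookup∘tabulate _ a)) ([]=⇒lookup a∈)))) ,
    (λ {a} qa → lookup⇒[]= a toSubset (trans (lookup∘tabulate _ a) (Equivalence.to T-≡ (fromWitness qa))))

closed𝔇⇒closed𝔄⇒closed𝔅 : (G : Graph) → Closed (𝔇 G) → Closed (𝔄 G) → Closed (𝔅 G)
closed𝔇⇒closed𝔄⇒closed𝔅 G closed𝔇 closed𝔄 (u , v) (u′ , v′) with closed𝔇 u u′ | closed𝔄 v v′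
... | inj₂ disjoint | _ = inj₂ λ x ((xu , _) , (xu′ , _)) → disjoint x (xu , xu′)
... | inj₁ _ | inj₂ disjoint = inj₂ λ x ((_ , vx) , (_ , v′x)) → disjoint x (vx , v′x)
... | inj₁ (w , Dw⊆ , ⊆Dw) | inj₁ (k , Ak⊆ , ⊆Ak) = inj₁ ((w , k) , Bwk⊆ , ⊆Bwk)
  where
  Bwk⊆ : B G w k ⊆ (B G u v ∩ B G u′ v′)
  Bwk⊆ (x∈Dw , x∈Ak) = let xu , xu′ = Dw⊆ x∈Dw ; vx , v′x = Ak⊆ x∈Ak in (xu , vx) , (xu′ , v′x)
  ⊆Bwk : (B G u v ∩ B G u′ v′) ⊆ B G w k
  ⊆Bwk ((xu , vx) , (xu′ , v′x)) = ⊆Dw (xu , xu′) , ⊆Ak (vx , v′x)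

module Network (N : Graph) (network : IsNetwork N) where
  open Graph N using (edge)

  infix 4 _≼_
  _≼_ : V N → V N → Set
  _≼_ = _⪯_ N

  arc? : ∀ u v → Dec (Arc N u v)
  arc? u v = T? (edge u v)

  module Descendants = FiniteAcyclic arc? (proj₁ network)
  module Ancestors = FiniteAcyclic (flip arc?) (λ u v vu p → proj₁ network v u vu (reverse id p))

  ≼? : ∀ u v → Dec (u ≼ v)
  ≼? u v = Descendants.star? v u

  ≼-trans : ∀ {u v w} → u ≼ v → v ≼ w → u ≼ w
  ≼-trans u≼v v≼w = v≼w ◅◅ u≼v

  ≼-antisym : ∀ {u v} → u ≼ v → v ≼ u → u ≡ v
  ≼-antisym ε       _   = refl
  ≼-antisym (a ◅ p) v≼u = ⊥-elim (proj₁ network _ _ a (p ◅◅ v≼u))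

  root : V N
  root = proj₁ (proj₂ network)

  ≼-root : ∀ v → v ≼ root
  ≼-root v with Ancestors.minimal U? {v} _
  ... | m , _ , v↝m , m-maximal = subst (v ≼_) m≡root (reverse id v↝m)
    where
    m≡root : m ≡ root
    m≡root = proj₂ (proj₂ (proj₂ network)) m λ w m≼w → m-maximal w _ (reverse id m≼w)

  UpperBound : Pred (V N) 0ℓ → Pred (V N) 0ℓ
  UpperBound Q c = ∀ a → Q a → a ≼ c

  IsJoin : Pred (V N) 0ℓ → Pred (V N) 0ℓ
  IsJoin Q w = UpperBound Q w × (∀ c → UpperBound Q c → w ≼ c)

  HasJoins : Set₁
  HasJoins = ∀ {Q} → Decidable Q → Satisfiable Q → ∃ (IsJoin Q)

  upperBound? : ∀ {Q} → Decidable Q → Decidable (UpperBound Q)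
  upperBound? Q? c = all? λ a → Q? a →-dec ≼? a c

  upperBound-antitone : ∀ {P Q} → P ⊆ Q → UpperBound Q ⊆ UpperBound P
  upperBound-antitone P⊆Q c-ub a pa = c-ub a (P⊆Q pa)

  isJoin-resp-≐ : ∀ {P Q} → P ≐ Q → IsJoin P ⊆ IsJoin Q
  isJoin-resp-≐ (P⊆Q , Q⊆P) (w-ub , w-least) =
    upperBound-antitone Q⊆P w-ub , λ c → w-least c ∘ upperBound-antitone P⊆Q

  globalLCA⇒hasJoins : GlobalLCA N → HasJoins
  globalLCA⇒hasJoins lca {Q} Q? (a , qa) with lca (toSubset Q?) (a , proj₂ (∈-toSubset Q?) qa)
  ... | w , (w-ub , _) , lca-unique = w , upperBound-antitone (proj₂ A≐Q) w-ub , w-least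
    where
    A≐Q = ∈-toSubset Q?
    w-least : ∀ c → UpperBound Q c → w ≼ c
    w-least c c-ub with Descendants.minimal (upperBound? Q?) {c} c-ub
    ... | m , m-ub , m≼c , m-minimal = subst (_≼ c) (lca-unique m m-lca) m≼c
      where
      m-lca : IsLCA N (toSubset Q?) m
      m-lca = upperBound-antitone (proj₁ A≐Q) m-ub ,
              λ v v-ub → m-minimal v (upperBound-antitone (proj₂ A≐Q) v-ub)

  hasJoins⇒globalLCA : HasJoins → GlobalLCA N
  hasJoins⇒globalLCA joins A nonempty with joins (_∈? A) nonempty
  ... | w , w-ub , w-least =
    w , (w-ub , λ v v-ub v≼w → ≼-antisym v≼w (w-least v v-ub)) ,
    λ v (v-ub , v-minimal) → sym (v-minimal w w-ub (w-least v v-ub))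

  D∩D? : ∀ u v → Decidable (D N u ∩ D N v)
  D∩D? u v x = ≼? x u ×-dec ≼? x v

  hasJoins⇒closed𝔇 : HasJoins → Closed (𝔇 N)
  hasJoins⇒closed𝔇 joins u v with any? (D∩D? u v)
  ... | no  disjoint = inj₂ λ x x∈ → disjoint (x , x∈)
  ... | yes common   with joins (D∩D? u v) common
  ...   | w , w-ub , w-least =
    inj₁ (w , (λ x≼w → ≼-trans x≼w w≼u , ≼-trans x≼w w≼v) , λ {x} → w-ub x)
    where
    w≼u : w ≼ u
    w≼u = w-least u λ _ → proj₁
    w≼v : w ≼ v
    w≼v = w-least v λ _ → proj₂

  closed𝔇⇒hasJoins : Closed (𝔇 N) → HasJoins
  closed𝔇⇒hasJoins closed {Q} Q? (a , qa) with Descendants.minimal (upperBound? Q?) {root} (λ x _ → ≼-root x)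
  ... | m , m-ub , _ , m-minimal = m , m-ub , m-least
    where
    m-least : ∀ c → UpperBound Q c → m ≼ c
    m-least c c-ub with closed m c
    ... | inj₂ disjoint         = ⊥-elim (disjoint a (m-ub a qa , c-ub a qa))
    ... | inj₁ (k , Dk⊆ , ⊆Dk) = subst (_≼ c) k≡m (proj₂ (Dk⊆ ε))
      where
      k≡m : k ≡ m
      k≡m = m-minimal k (λ x qx → ⊆Dk (m-ub x qx , c-ub x qx)) (proj₁ (Dk⊆ ε))

  hasJoins⇒closed𝔄 : HasJoins → Closed (𝔄 N)
  hasJoins⇒closed𝔄 joins u v with joins (λ x → x ≟ u ⊎-dec x ≟ v) (u , inj₁ refl)
  ... | w , w-ub , w-least =
    inj₁ (w , (λ w≼x → ≼-trans (w-ub u (inj₁ refl)) w≼x , ≼-trans (w-ub v (inj₂ refl)) w≼x) ,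
              λ {x} (u≼x , v≼x) → w-least x λ { _ (inj₁ refl) → u≼x ; _ (inj₂ refl) → v≼x })

  closed𝔄⇒listJoin : Closed (𝔄 N) → ∀ {xs} → Satisfiable (_∈ₗ xs) → ∃ (IsJoin (_∈ₗ xs))
  closed𝔄⇒listJoin closed {[]}         (_ , ())
  closed𝔄⇒listJoin closed {x ∷ []}     _ = x , (λ { _ (here refl) → ε }) , λ c c-ub → c-ub x (here refl)
  closed𝔄⇒listJoin closed {x ∷ y ∷ ys} _ with closed𝔄⇒listJoin closed {y ∷ ys} (y , here refl)
  ... | s , s-ub , s-least with closed x s
  ...   | inj₂ disjoint         = ⊥-elim (disjoint root (≼-root x , ≼-root s))
  ...   | inj₁ (k , Ak⊆ , ⊆Ak) =
    k , k-ub , λ c c-ub → ⊆Ak (c-ub x (here refl) , s-least c (λ z → c-ub z ∘ there))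
    where
    k-ub : UpperBound (_∈ₗ x ∷ y ∷ ys) k
    k-ub _ (here refl) = proj₁ (Ak⊆ ε)
    k-ub z (there z∈)  = ≼-trans (s-ub z z∈) (proj₂ (Ak⊆ ε))

  closed𝔄⇒hasJoins : Closed (𝔄 N) → HasJoins
  closed𝔄⇒hasJoins closed {Q} Q? (a , qa) =
    let w , w-join = closed𝔄⇒listJoin closed (a , proj₂ filter≐Q qa) in w , isJoin-resp-≐ filter≐Q w-join
    where
    filter≐Q : (_∈ₗ filter Q? (allFin _)) ≐ Q
    filter≐Q = proj₂ ∘ ∈-filter⁻ Q? {xs = allFin _} , ∈-filter⁺ Q? (∈-allFin _)

  closed𝔅⇒closed𝔄 : Closed (𝔅 N) → Closed (𝔄 N)
  closed𝔅⇒closed𝔄 closed u v with closed (root , u) (root , v)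
  ... | inj₂ disjoint = ⊥-elim (disjoint root ((ε , ≼-root u) , (ε , ≼-root v)))
  ... | inj₁ ((x , y) , Bxy⊆ , ⊆Bxy) = inj₁ (y , Ay⊆ , ⊆Ay)
    where
    root≼x : root ≼ x
    root≼x = proj₁ (⊆Bxy ((ε , ≼-root u) , (ε , ≼-root v)))
    Ay⊆ : ANC N y ⊆ (ANC N u ∩ ANC N v)
    Ay⊆ {z} y≼z = let (_ , u≼z) , (_ , v≼z) = Bxy⊆ (≼-trans (≼-root z) root≼x , y≼z) in u≼z , v≼z
    ⊆Ay : (ANC N u ∩ ANC N v) ⊆ ANC N y
    ⊆Ay {z} (u≼z , v≼z) = proj₂ (⊆Bxy ((≼-root z , u≼z) , (≼-root z , v≼z)))

  globalLCA⇔hasJoins : GlobalLCA N ⇔ HasJoins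
  globalLCA⇔hasJoins = mk⇔ globalLCA⇒hasJoins hasJoins⇒globalLCA

  hasJoins⇔closed𝔇 : HasJoins ⇔ Closed (𝔇 N)
  hasJoins⇔closed𝔇 = mk⇔ hasJoins⇒closed𝔇 closed𝔇⇒hasJoins

  hasJoins⇔closed𝔄 : HasJoins ⇔ Closed (𝔄 N)
  hasJoins⇔closed𝔄 = mk⇔ hasJoins⇒closed𝔄 closed𝔄⇒hasJoins

  hasJoins⇔closed𝔅 : HasJoins ⇔ Closed (𝔅 N)
  hasJoins⇔closed𝔅 = mk⇔
    (λ (joins : HasJoins) →
       closed𝔇⇒closed𝔄⇒closed𝔅 N (hasJoins⇒closed𝔇 joins) (hasJoins⇒closed𝔄 joins))
    (closed𝔄⇒hasJoins ∘ closed𝔅⇒closed𝔄)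

theorem7p8 : (N : Graph) → IsNetwork N →
    (GlobalLCA N ⇔ Closed (𝔇 N)) × (GlobalLCA N ⇔ Closed (𝔄 N)) × (GlobalLCA N ⇔ Closed (𝔅 N))
theorem7p8 N network =
  ⇔-trans globalLCA⇔hasJoins hasJoins⇔closed𝔇 ,
  ⇔-trans globalLCA⇔hasJoins hasJoins⇔closed𝔄 ,
  ⇔-trans globalLCA⇔hasJoins hasJoins⇔closed𝔅
  where open Network N network
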